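{- For integers $0\le s\le t$, \[ \max_{0\le r\le s}\frac{H_{s,r}}{H_{t,r}}\le 2^{2s+1}. \]
   Context: For integers $0\le r\le m$, let $H_{m,r}:=\frac{1}{2r+1}\prod_{j=0}^{r-1}\frac{m+j+2}{m-j}$ (empty product $=1$); equivalently $H_{m,r}=\frac{(m+r+1)!(m-r)!}{(2r+1)(m!)^2(m+1)}$, the squared norm $\frac1{m+1}\sum_{x=0}^m Q_r^{(m)}(x)^2$ of the Hahn polynomial $Q_r^{(m)}(x)=\sum_{\ell=0}^r(-1)^\ell\binom r\ell\binom{r+\ell}{\ell}\frac{x^{\underline\ell}}{m^{\underline\ell}}$, where $x^{\underline\ell}=x(x-1)\cdots(x-\ell+1)$. -}

module Defs where

open import Data.Nat as ℕ using (ℕ; suc; _+_; _*_; _∸_; _!; _≤_)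
open import Data.Nat.Properties as ℕP using (_!≢0; m*n≢0)
open import Data.Integer using (+_)
open import Data.Rational as ℚ using (ℚ; _/_; _÷_; NonZero; normalize)
open import Data.Rational.Properties using (pos⇒nonZero; normalize-pos)

Hden : ℕ → ℕ → ℕ
Hden m r = suc (2 * r) * (m ! * m !) * suc m

-- Numerator of H_{m,r}: (m+r+1)! (m-r)!   (used only for r ≤ m)
Hnum : ℕ → ℕ → ℕ
Hnum m r = (m + r + 1) ! * (m ∸ r) !

Hden≢0 : ∀ m r → ℕ.NonZero (Hden m r)
Hden≢0 m r =
  m*n≢0 (suc (2 * r) * (m ! * m !)) (suc m)
    {{m*n≢0 (suc (2 * r)) (m ! * m !) {{_}} {{m*n≢0 (m !) (m !) {{m !≢0}} {{m !≢0}}}}}}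

H : ℕ → ℕ → ℚ
H m r = _/_ (+ Hnum m r) (Hden m r) {{Hden≢0 m r}}

H≢0 : ∀ m r → NonZero (H m r)
H≢0 m r = pos⇒nonZero (H m r)
  {{normalize-pos (Hnum m r) (Hden m r)
    {{Hden≢0 m r}} {{m*n≢0 ((m + r + 1) !) ((m ∸ r) !) {{(m + r + 1) !≢0}} {{(m ∸ r) !≢0}}}}}}

-- Since H_{m,r} = (m+r+1)!(m-r)! / ((2r+1) (m+1)! m!), the ratio H_{s,r}/H_{t,r} equals
-- (s+r+1)!(s-r)! (t+1)! t! / ((s+1)! s! (t+r+1)!(t-r)!). The numerator (m+r+1)!(m-r)! is
-- nondecreasing in r on [0,m], running from (m+1)! m! at r = 0 to (2m+1)! at r = m. Hence the
-- ratio is at most (2s+1)! / ((s+1)! s!) = binomial(2s+1, s) ≤ 2^{2s+1}.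
module Submission where

open import Defs
open import Data.Nat using (ℕ; _≤_; _^_; _*_; _+_)
open import Data.Integer using (+_)
open import Data.Rational using (ℚ; _÷_; _/_) renaming (_≤_ to _≤ℚ_)

open import Data.Nat as ℕ using (suc; _∸_; _!; _≤′_; ≤′-refl; ≤′-step; z≤n; s≤s)
open import Data.Nat.Properties
open import Data.Nat.Tactic.RingSolver using (solve-∀)
open import Relation.Binary.PropositionalEquality
import Data.Integer as ℤ
import Data.Integer.Properties as ℤP
import Data.Rational as ℚ
import Data.Rational.Properties as ℚP
import Data.Rational.Unnormalised as ℚᵘ
import Data.Rational.Unnormalised.Properties as ℚᵘP

n!*[1+k]!≤[1+n]!*k! : ∀ {n k} → k ≤ n → n ! * suc k ! ≤ suc n ! * k !
n!*[1+k]!≤[1+n]!*k! {n} {k} k≤n = begin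
  n ! * (suc k * k !)   ≡⟨ reorder (n !) (k !) (suc k) ⟩
  suc k * (n ! * k !)   ≤⟨ *-monoˡ-≤ (n ! * k !) (s≤s k≤n) ⟩
  suc n * (n ! * k !)   ≡⟨ *-assoc (suc n) (n !) (k !) ⟨
  (suc n * n !) * k !   ∎
  where
  open ≤-Reasoning
  reorder : ∀ x y z → x * (z * y) ≡ z * (x * y)
  reorder = solve-∀

Hnum-stepʳ : ∀ {m r} → suc r ≤ m → Hnum m r ≤ Hnum m (suc r)
Hnum-stepʳ {suc m} {r} (s≤s r≤m) = begin
  X ! * (suc m ∸ r) !       ≡⟨ cong (λ k → X ! * k !) (+-∸-assoc 1 r≤m) ⟩
  X ! * suc (m ∸ r) !       ≤⟨ n!*[1+k]!≤[1+n]!*k! {X} (≤-trans (m∸n≤m m r) m≤X) ⟩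
  suc X ! * (m ∸ r) !       ≡⟨ cong (λ n → (n + 1) ! * (m ∸ r) !) (+-suc (suc m) r) ⟨
  Hnum (suc m) (suc r)      ∎
  where
  open ≤-Reasoning
  X = suc m + r + 1
  m≤X : m ≤ X
  m≤X = m≤n⇒m≤1+n (≤-trans (m≤m+n m r) (m≤m+n (m + r) 1))

Hnum-monoʳ-≤ : ∀ {m r r′} → r ≤ r′ → r′ ≤ m → Hnum m r ≤ Hnum m r′
Hnum-monoʳ-≤ r≤r′ = go (≤⇒≤′ r≤r′)
  where
  go : ∀ {m r r′} → r ≤′ r′ → r′ ≤ m → Hnum m r ≤ Hnum m r′
  go ≤′-refl           _    = ≤-refl
  go (≤′-step r≤′r′) r′<m = ≤-trans (go r≤′r′ (<⇒≤ r′<m)) (Hnum-stepʳ r′<m)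

Hnum-zeroʳ : ∀ m → Hnum m 0 ≡ suc m ! * m !
Hnum-zeroʳ m = cong (λ n → n ! * m !) (trans (cong (_+ 1) (+-identityʳ m)) (+-comm m 1))

Hnum-diag : ∀ m → Hnum m m ≡ (m + m + 1) !
Hnum-diag m = trans (cong (λ k → (m + m + 1) ! * k !) (n∸n≡0 m)) (*-identityʳ _)

Hden≡[1+2r]*Hnum[m,0] : ∀ m r → Hden m r ≡ suc (2 * r) * Hnum m 0
Hden≡[1+2r]*Hnum[m,0] m r = trans (reorder (suc (2 * r)) (m !) m) (cong (suc (2 * r) *_) (sym (Hnum-zeroʳ m)))
  where
  reorder : ∀ c f m → c * (f * f) * suc m ≡ c * ((suc m * f) * f)
  reorder = solve-∀

[2n+1]!≤2^[2n+1]*[n+1]!*n! : ∀ n → (n + n + 1) ! ≤ 2 ^ (2 * n + 1) * (suc n ! * n !)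
[2n+1]!≤2^[2n+1]*[n+1]!*n! 0 = s≤s z≤n
[2n+1]!≤2^[2n+1]*[n+1]!*n! (suc n) = begin
  (suc n + suc n + 1) !                            ≡⟨ cong _! (index n) ⟩
  suc (suc X) * (suc X * X !)                      ≤⟨ *-monoʳ-≤ (suc (suc X)) (*-monoʳ-≤ (suc X) ih) ⟩
  suc (suc X) * (suc X * (P * B))                  ≤⟨ *-monoˡ-≤ (suc X * (P * B)) (n≤1+n (suc (suc X))) ⟩
  suc (suc (suc X)) * (suc X * (P * B))            ≡⟨ regroup n (n !) P ⟩
  (4 * P) * (suc (suc n) ! * suc n !)              ≡⟨ cong (_* (suc (suc n) ! * suc n !)) (^-distribˡ-+-* 2 2 (2 * n + 1)) ⟨
  2 ^ (2 + (2 * n + 1)) * (suc (suc n) ! * suc n !) ≡⟨ cong (λ e → 2 ^ e * (suc (suc n) ! * suc n !)) (exponent n) ⟩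
  2 ^ (2 * suc n + 1) * (suc (suc n) ! * suc n !)  ∎
  where
  open ≤-Reasoning
  X = n + n + 1
  P = 2 ^ (2 * n + 1)
  B = suc n ! * n !
  ih = [2n+1]!≤2^[2n+1]*[n+1]!*n! n
  index : ∀ n → suc n + suc n + 1 ≡ suc (suc (n + n + 1))
  index = solve-∀
  exponent : ∀ n → 2 + (2 * n + 1) ≡ 2 * suc n + 1
  exponent = solve-∀
  regroup : ∀ n f P → suc (suc (suc (n + n + 1))) * (suc (n + n + 1) * (P * ((suc n * f) * f)))
                    ≡ (4 * P) * ((suc (suc n) * (suc n * f)) * (suc n * f))
  regroup = solve-∀

Hnum*Hden-bound : ∀ {s t r} → s ≤ t → r ≤ s →
  Hnum s r * Hden t r ≤ 2 ^ (2 * s + 1) * Hnum t r * Hden s r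
Hnum*Hden-bound {s} {t} {r} s≤t r≤s = begin
  Hnum s r * Hden t r               ≡⟨ cong (Hnum s r *_) (Hden≡[1+2r]*Hnum[m,0] t r) ⟩
  Hnum s r * (c * Hnum t 0)         ≤⟨ *-mono-≤ Hnum[s,r]≤K*Hnum[s,0] (*-monoʳ-≤ c Hnum[t,0]≤Hnum[t,r]) ⟩
  (K * Hnum s 0) * (c * Hnum t r)   ≡⟨ reorder K (Hnum s 0) (Hnum t r) c ⟩
  K * Hnum t r * (c * Hnum s 0)     ≡⟨ cong (K * Hnum t r *_) (Hden≡[1+2r]*Hnum[m,0] s r) ⟨
  K * Hnum t r * Hden s r           ∎
  where
  open ≤-Reasoning
  K = 2 ^ (2 * s + 1)
  c = suc (2 * r)
  Hnum[s,r]≤K*Hnum[s,0] : Hnum s r ≤ K * Hnum s 0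
  Hnum[s,r]≤K*Hnum[s,0] = begin
    Hnum s r          ≤⟨ Hnum-monoʳ-≤ r≤s ≤-refl ⟩
    Hnum s s          ≡⟨ Hnum-diag s ⟩
    (s + s + 1) !     ≤⟨ [2n+1]!≤2^[2n+1]*[n+1]!*n! s ⟩
    K * (suc s ! * s !) ≡⟨ cong (K *_) (Hnum-zeroʳ s) ⟨
    K * Hnum s 0      ∎
  Hnum[t,0]≤Hnum[t,r] : Hnum t 0 ≤ Hnum t r
  Hnum[t,0]≤Hnum[t,r] = Hnum-monoʳ-≤ z≤n (≤-trans r≤s s≤t)
  reorder : ∀ K a b c → (K * a) * (c * b) ≡ K * b * (c * a)
  reorder = solve-∀

m*q≤n*p⇒m/p≤n/q : ∀ m n p q .{{_ : ℕ.NonZero p}} .{{_ : ℕ.NonZero q}} →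
  m * q ≤ n * p → + m / p ≤ℚ + n / q
m*q≤n*p⇒m/p≤n/q m n (suc p) (suc q) mq≤np = ℚP.toℚᵘ-cancel-≤ (begin
  ℚ.toℚᵘ (+ m / suc p)   ≃⟨ ℚP.toℚᵘ-fromℚᵘ (ℚᵘ.mkℚᵘ (+ m) p) ⟩
  ℚᵘ.mkℚᵘ (+ m) p         ≤⟨ ℚᵘ.*≤* (subst₂ ℤ._≤_ (ℤP.pos-* m (suc q)) (ℤP.pos-* n (suc p)) (ℤ.+≤+ mq≤np)) ⟩
  ℚᵘ.mkℚᵘ (+ n) q         ≃⟨ ℚP.toℚᵘ-fromℚᵘ (ℚᵘ.mkℚᵘ (+ n) q) ⟨
  ℚ.toℚᵘ (+ n / suc q)   ∎)
  where open ℚᵘP.≤-Reasoning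

k/1*m/p≡[k*m]/p : ∀ k m p .{{_ : ℕ.NonZero p}} → (+ k / 1) ℚ.* (+ m / p) ≡ + (k * m) / p
k/1*m/p≡[k*m]/p k m (suc p) = ℚP.toℚᵘ-injective (begin
  ℚ.toℚᵘ ((+ k / 1) ℚ.* (+ m / suc p))                ≈⟨ ℚP.toℚᵘ-homo-* (+ k / 1) (+ m / suc p) ⟩
  ℚ.toℚᵘ (+ k / 1) ℚᵘ.* ℚ.toℚᵘ (+ m / suc p)        ≈⟨ ℚᵘP.*-cong (ℚP.toℚᵘ-fromℚᵘ (ℚᵘ.mkℚᵘ (+ k) 0)) (ℚP.toℚᵘ-fromℚᵘ (ℚᵘ.mkℚᵘ (+ m) p)) ⟩
  ℚᵘ.mkℚᵘ (+ k) 0 ℚᵘ.* ℚᵘ.mkℚᵘ (+ m) p                ≈⟨ ℚᵘ.*≡* (cong₂ ℤ._*_ (sym (ℤP.pos-* k m)) (cong (λ n → + suc n) (sym (+-identityʳ p)))) ⟩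
  ℚᵘ.mkℚᵘ (+ (k * m)) p                               ≈⟨ ℚP.toℚᵘ-fromℚᵘ (ℚᵘ.mkℚᵘ (+ (k * m)) p) ⟨
  ℚ.toℚᵘ (+ (k * m) / suc p)                          ∎)
  where open ℚᵘP.≃-Reasoning

p≤r*q⇒p÷q≤r : ∀ p q r .{{_ : ℚ.Positive q}} → p ≤ℚ r ℚ.* q → (p ÷ q) {{ℚP.pos⇒nonZero q}} ≤ℚ r
p≤r*q⇒p÷q≤r p q r p≤rq = begin
  p ℚ.* ℚ.1/ q              ≤⟨ ℚP.*-monoʳ-≤-nonNeg (ℚ.1/ q) {{ℚP.pos⇒nonNeg (ℚ.1/ q) {{ℚP.1/pos⇒pos q}}}} p≤rq ⟩
  (r ℚ.* q) ℚ.* ℚ.1/ q      ≡⟨ ℚP.*-assoc r q (ℚ.1/ q) ⟩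
  r ℚ.* (q ℚ.* ℚ.1/ q)      ≡⟨ cong (r ℚ.*_) (ℚP.*-inverseʳ q) ⟩
  r ℚ.* ℚ.1ℚ                ≡⟨ ℚP.*-identityʳ r ⟩
  r                         ∎
  where
  instance _ = ℚP.pos⇒nonZero q
  open ℚP.≤-Reasoning

H-pos : ∀ m r → ℚ.Positive (H m r)
H-pos m r = ℚP.normalize-pos (Hnum m r) (Hden m r)
  {{Hden≢0 m r}} {{m*n≢0 ((m + r + 1) !) ((m ∸ r) !) {{(m + r + 1) !≢0}} {{(m ∸ r) !≢0}}}}

lemma2 : (s t : ℕ) → s ≤ t → (r : ℕ) → r ≤ s →
    (_÷_ (H s r) (H t r) {{H≢0 t r}}) ≤ℚ ((+ (2 ^ (2 * s + 1))) / 1)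
lemma2 s t s≤t r r≤s = p≤r*q⇒p÷q≤r (H s r) (H t r) (+ K / 1) {{H-pos t r}} (begin
  H s r                              ≤⟨ m*q≤n*p⇒m/p≤n/q (Hnum s r) (K * Hnum t r) (Hden s r) (Hden t r)
                                          (Hnum*Hden-bound s≤t r≤s) ⟩
  + (K * Hnum t r) / Hden t r        ≡⟨ k/1*m/p≡[k*m]/p K (Hnum t r) (Hden t r) ⟨
  (+ K / 1) ℚ.* H t r                ∎)
  where
  open ℚP.≤-Reasoning
  K = 2 ^ (2 * s + 1)
  instance
    _ = Hden≢0 s r
    _ = Hden≢0 t r
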